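{- Let $c=s_1s_2\cdots s_n$ and let $w$ be a $c$-singleton in $A_n$. Then for each $y\in[n+1]$ and each $0\le z\le y-1$, there is exactly one value in $\{w(1),\dots,w(y)\}$ congruent to $z$ modulo $y$. Consequently, for every $X\in\mathsf{Aff}(c)$, $$\sum_{\{j\in[n+1]:\ j\equiv z \pmod y\}}\ \sum_{i=1}^{y}X(i,j)=1.$$
   Context: $A_n$ is the symmetric group on $[n+1]$, $s_i$ exchanges $i,i+1$, permutations compose as functions. For a Coxeter element $c=s_{a_1}\cdots s_{a_n}$, $\mathrm{sort}_c(w)$ is the lexicographically first subword of $c^\infty=a_1\cdots a_na_1\cdots a_n\cdots$ that is a reduced word for $w$; $w$ is $c$-sortable if the sets $K_j$ of letters from the $j$-th copy satisfy $K_1\supseteq K_2\supseteq\cdots$; $\pi^c_\downarrow(w)$ is the largest $c$-sortable element weakly below $w$ in right weak order; a $c$-singleton is a $c$-sortable $w$ with $(\pi^c_\downarrow)^{ -1}(w)=\{w\}$. (For $c=s_1\cdots s_n$ these are exactly the permutations avoiding the patterns $132$ and $312$.) $X(w)$ is the $(n+1)\times(n+1)$ matrix with $1$ at $(i,w(i))$ and $0$ elsewhere; $\mathsf{Aff}(c)$ is the affine span of $\{X(w): w \text{ a } c\text{ -singleton}\}$. -}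

module Defs where

open import Level using (Level)
open import Data.Nat using (ℕ; zero; suc; _<_; _≤_; _%_)
open import Data.Fin using (Fin; toℕ; inject₁) renaming (suc to fsuc)
open import Data.Fin.Properties using (_≟_)
open import Data.Fin.Permutation using (Permutation′; _⟨$⟩ʳ_)
open import Data.List using (List; []; _∷_; _++_; map; length)
open import Data.List.Membership.Propositional using (_∈_)
open import Data.List.Relation.Unary.All using (All)
open import Data.Product using (Σ; ∃; _×_; _,_; proj₁; proj₂)
open import Data.Sum using (_⊎_)
open import Data.Bool using (Bool; true; false; if_then_else_)
open import Relation.Nullary using (¬_)
open import Relation.Nullary.Decidable using (⌊_⌋)
open import Relation.Binary.PropositionalEquality using (_≡_)
open import Function using (id; _∘_)
open import Algebra.Bundles using (CommutativeRing)

-- The symmetric group A_n on [n+1] = Fin (suc n) (0-indexed: the value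
-- k : Fin (suc n) stands for k+1 ∈ [n+1]).

Perm : ℕ → Set
Perm n = Permutation′ (suc n)

_≐_ : ∀ {n} → Perm n → Perm n → Set
u ≐ w = ∀ i → u ⟨$⟩ʳ i ≡ w ⟨$⟩ʳ i

-- the simple transposition s_{i+1} (i : Fin n), exchanging i+1 and i+2
-- (0-indexed: inject₁ i and fsuc i)
swapFn : ∀ {m} → Fin m → Fin m → Fin m → Fin m
swapFn a b k = if ⌊ k ≟ a ⌋ then b else (if ⌊ k ≟ b ⌋ then a else k)

sFn : ∀ {n} → Fin n → Fin (suc n) → Fin (suc n)
sFn i = swapFn (inject₁ i) (fsuc i)

-- a word a_1 ... a_k in the letters (Fin n) evaluates to
-- s_{a_1} ∘ ... ∘ s_{a_k}  (permutations compose as functions)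
Word : ℕ → Set
Word n = List (Fin n)

eval : ∀ {n} → Word n → Fin (suc n) → Fin (suc n)
eval []       = id
eval (a ∷ as) = sFn a ∘ eval as

IsWordFor : ∀ {n} → Word n → Perm n → Set
IsWordFor ws w = ∀ i → eval ws i ≡ w ⟨$⟩ʳ i

IsReduced : ∀ {n} → Word n → Perm n → Set
IsReduced {n} ws w = IsWordFor ws w × (∀ (vs : Word n) → IsWordFor vs w → length ws ≤ length vs)

-- right weak order: u ≤ w iff some reduced word of w has a prefix that is
-- a word for u (equivalently w = u v with ℓ(w) = ℓ(u) + ℓ(v))
_≤R_ : ∀ {n} → Perm n → Perm n → Set
_≤R_ {n} u w = Σ (Word n) λ us → Σ (Word n) λ vs → IsReduced (us ++ vs) w × IsWordFor us u

-- c = s_1 s_2 ... s_n and the infinite word c^∞.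
-- A position in c^∞ is a pair (j , k): the letter k (i.e. s_{k+1}) in
-- the (j+1)-th copy of c.  Positions are ordered lexicographically.

Pos : ℕ → Set
Pos n = ℕ × Fin n

_<P_ : ∀ {n} → Pos n → Pos n → Set
(j , k) <P (j′ , k′) = j < j′ ⊎ (j ≡ j′ × toℕ k < toℕ k′)

-- subwords of c^∞ = strictly increasing lists of positions
data Increasing {n} : List (Pos n) → Set where
  inc[]  : Increasing []
  inc[-] : ∀ p → Increasing (p ∷ [])
  inc∷   : ∀ {p q ps} → p <P q → Increasing (q ∷ ps) → Increasing (p ∷ q ∷ ps)

letters : ∀ {n} → List (Pos n) → Word n
letters = map proj₂

data LexLe {n} : List (Pos n) → List (Pos n) → Set where
  lex-refl  : ∀ {ps} → LexLe ps ps
  lex-here  : ∀ {p q ps qs} → p <P q → LexLe (p ∷ ps) (q ∷ qs)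
  lex-there : ∀ {p ps qs} → LexLe ps qs → LexLe (p ∷ ps) (p ∷ qs)

IsSortWord : ∀ {n} → Perm n → List (Pos n) → Set
IsSortWord {n} w ps =
  Increasing ps × IsReduced (letters ps) w ×
  (∀ (qs : List (Pos n)) → Increasing qs → IsReduced (letters qs) w → LexLe ps qs)

-- K_1 ⊇ K_2 ⊇ ... : every letter used in copy j+1 is used in copy j
Nested : ∀ {n} → List (Pos n) → Set
Nested {n} ps = ∀ (j : ℕ) (k : Fin n) → (suc j , k) ∈ ps → (j , k) ∈ ps

Sortable : ∀ {n} → Perm n → Set
Sortable {n} w = Σ (List (Pos n)) λ ps → IsSortWord w ps × Nested ps

IsPiDown : ∀ {n} → Perm n → Perm n → Set
IsPiDown {n} w v = Sortable v × v ≤R w × (∀ (v′ : Perm n) → Sortable v′ → v′ ≤R w → v′ ≤R v)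

Singleton : ∀ {n} → Perm n → Set
Singleton {n} w = Sortable w × (∀ (u : Perm n) → IsPiDown u w → u ≐ w)

module _ {a ℓ : Level} (R : CommutativeRing a ℓ) where
  open CommutativeRing R

  sumFin : ∀ {m} → (Fin m → Carrier) → Carrier
  sumFin {zero}  f = 0#
  sumFin {suc m} f = f Fin.zero + sumFin (f ∘ fsuc)
    where import Data.Fin as Fin

  sumList : List Carrier → Carrier
  sumList []       = 0#
  sumList (x ∷ xs) = x + sumList xs

  permMatrix : ∀ {n} → Perm n → Fin (suc n) → Fin (suc n) → Carrier
  permMatrix w i j = if ⌊ w ⟨$⟩ʳ i ≟ j ⌋ then 1# else 0#

  InAff : ∀ {n} → (Fin (suc n) → Fin (suc n) → Carrier) → Set (a Level.⊔ ℓ)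
  InAff {n} X = Σ (List (Carrier × Perm n)) λ cs →
      All (λ p → Singleton (proj₂ p)) cs
    × sumList (map proj₁ cs) ≈ 1#
    × (∀ i j → X i j ≈ sumList (map (λ p → proj₁ p * permMatrix (proj₂ p) i j) cs))

{-# OPTIONS --safe #-}

-- For c = s₁⋯sₙ a c-sortable permutation avoids 312: along its sorting word every 132 stays split by a
-- wall, a letter that does not occur again, so no later letter can turn it into a 312.  A c-singleton w
-- also avoids 132: a 132 contains an adjacent pair i, i + 1 with w(i) < w(r) < w(i + 1) for its last
-- position r, and then every sortable element below w sᵢ is already below w, so π↓(w sᵢ) = w.  Avoiding
-- both patterns, each prefix w(1), …, w(y) is an interval of y consecutive values, and such an interval
-- contains exactly one representative of each residue modulo y.  The block sum in (2) is a linear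
-- functional that equals 1 on X(w) for every singleton w, hence on their affine span.

module Submission where

open import Defs
open import Data.Nat using (ℕ; suc; _<_; _≤_; _%_; _≤?_)
open import Data.Fin using (Fin; toℕ)
open import Data.Fin.Permutation using (_⟨$⟩ʳ_)
open import Data.Product using (Σ; _×_; _,_)
open import Data.Bool using (if_then_else_)
open import Data.Nat.Properties using (_≟_)
open import Relation.Nullary.Decidable using (⌊_⌋)
open import Relation.Binary.PropositionalEquality using (_≡_)
open import Algebra.Bundles using (CommutativeRing)

open import Level using (_⊔_)
open import Function using (id; _∘_)
open import Function.Definitions using (Injective)
open import Data.Empty using (⊥; ⊥-elim)
open import Data.Bool using (Bool; true; false)
open import Data.Sum using (_⊎_; inj₁; inj₂)
open import Data.Product using (∃; proj₁; proj₂)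
open import Data.Nat using (zero; _+_; _*_; _∸_; _/_; z≤n; s≤s; s≤s⁻¹; _<?_)
open import Data.Nat.Properties
  using ( suc-injective; +-suc; +-comm; +-identityʳ; +-monoˡ-≤; +-monoʳ-≤; +-cancelʳ-≤; 1+n≢n
        ; <-cmp; <-trans; <-irrefl; <-asym; <⇒≯; <⇒≤; ≤⇒≯; ≮⇒≥; ≤∧≢⇒<; <-≤-trans; ≤-total
        ; ≤-refl; ≤-trans; ≤-reflexive; ≤-antisym; n≤1+n; n<1+n; m<n⇒m<1+n; m<m+n; m≤m+n
        ; m≤n⇒m<n∨m≡n; m<1+n⇒m<n∨m≡n; ∸-monoˡ-<; m+n∸m≡n; m∸n≡0⇒m≤n; [m+n]∸[m+o]≡n∸o; *-distribʳ-∸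
        ; +-commutativeSemigroup; module ≤-Reasoning)
open import Data.Nat.DivMod using (m≡m%n+[m/n]*n; m<n⇒m%n≡m; m*n%n≡0; [m+n]%n≡m%n)
open import Algebra.Properties.CommutativeSemigroup +-commutativeSemigroup
  using () renaming (x∙yz≈y∙xz to +-exchange)
open import Data.Fin using (inject₁; fromℕ; fromℕ<) renaming (zero to fzero; suc to fsuc)
import Data.Fin.Properties as Finₚ
open import Data.Fin.Induction using (<-weakInduction; >-weakInduction)
open import Data.Fin.Permutation using (_⟨$⟩ˡ_; inverseˡ; inverseʳ; permutation)
open import Data.List using (List; []; _∷_; _++_; _∷ʳ_; length; map)
open import Data.List.Properties using (length-++; ∷ʳ-injectiveʳ; ∷ʳ-++)
open import Data.List.Relation.Unary.All using (All; []; _∷_)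
open import Data.List.Relation.Unary.Any using (here; there)
open import Data.List.Membership.Propositional using (_∈_; _∉_)
open import Data.List.Membership.Propositional.Properties using (∈-map⁻; ∈-++⁻; ∈-++⁺ʳ)
import Data.List.Membership.DecPropositional as DecMembership
open import Relation.Nullary using (¬_; yes; no; Dec)
open import Relation.Nullary.Decidable using (_×-dec_)
open import Relation.Binary.Definitions using (tri<; tri≈; tri>)
open import Relation.Binary.PropositionalEquality
  using (_≢_; _≗_; refl; sym; trans; cong; cong₂; subst; subst₂; module ≡-Reasoning)

private
  variable
    m n : ℕ

-- Adjacent transpositions

swap : Fin n → Fin (suc n) → Fin (suc n)
swap fzero    fzero               = fsuc fzero
swap fzero    (fsuc fzero)        = fzero
swap fzero    (fsuc (fsuc k))     = fsuc (fsuc k)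
swap (fsuc a) fzero               = fzero
swap (fsuc a) (fsuc k)            = fsuc (swap a k)

sFn≗swap : (a : Fin n) → sFn a ≗ swap a
sFn≗swap fzero    fzero           = refl
sFn≗swap fzero    (fsuc fzero)    = refl
sFn≗swap fzero    (fsuc (fsuc k)) = refl
sFn≗swap (fsuc a) fzero           = refl
sFn≗swap (fsuc a) (fsuc k) with k Finₚ.≟ inject₁ a | k Finₚ.≟ fsuc a | sFn≗swap a k
... | yes _ | _     | e = cong fsuc e
... | no _  | yes _ | e = cong fsuc e
... | no _  | no _  | e = cong fsuc e

swap-involutive : (a : Fin n) → swap a ∘ swap a ≗ id
swap-involutive fzero    fzero           = refl
swap-involutive fzero    (fsuc fzero)    = refl
swap-involutive fzero    (fsuc (fsuc k)) = refl
swap-involutive (fsuc a) fzero           = refl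
swap-involutive (fsuc a) (fsuc k)        = cong fsuc (swap-involutive a k)

swap-inject₁ : (a : Fin n) → swap a (inject₁ a) ≡ fsuc a
swap-inject₁ fzero    = refl
swap-inject₁ (fsuc a) = cong fsuc (swap-inject₁ a)

swap-suc : (a : Fin n) → swap a (fsuc a) ≡ inject₁ a
swap-suc fzero    = refl
swap-suc (fsuc a) = cong fsuc (swap-suc a)

inject₁≢suc : (a : Fin n) → inject₁ a ≢ fsuc a
inject₁≢suc a e = 1+n≢n (trans (cong toℕ (sym e)) (Finₚ.toℕ-inject₁ a))

data SwapView (a : Fin n) : Fin (suc n) → Set where
  left    : SwapView a (inject₁ a)
  right   : SwapView a (fsuc a)
  fixed : ∀ {k} → swap a k ≡ k → SwapView a k

swapView : (a : Fin n) (k : Fin (suc n)) → SwapView a k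
swapView fzero    fzero           = left
swapView fzero    (fsuc fzero)    = right
swapView fzero    (fsuc (fsuc k)) = fixed refl
swapView (fsuc a) fzero           = fixed refl
swapView (fsuc a) (fsuc k) with swapView a k
... | left      = left
... | right     = right
... | fixed fix = fixed (cong fsuc fix)

swap-fixes : (a : Fin n) (k : Fin (suc n)) → toℕ k ≢ toℕ a → toℕ k ≢ suc (toℕ a) → swap a k ≡ k
swap-fixes a k p q with swapView a k
... | left    = ⊥-elim (p (Finₚ.toℕ-inject₁ a))
... | right   = ⊥-elim (q refl)
... | fixed e = e

swap-fixes-below : (a : Fin n) (p : Fin (suc n)) → toℕ p < toℕ (inject₁ a) → swap a p ≡ p
swap-fixes-below a p p<a = swap-fixes a p (λ p≡a → <-irrefl (trans p≡a (sym ι)) p<a)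
                                          (λ p≡1+a → <-asym p<a (subst₂ _<_ (sym ι) (sym p≡1+a) (n<1+n _)))
  where
  ι : toℕ (inject₁ a) ≡ toℕ a
  ι = Finₚ.toℕ-inject₁ a

swap-fixes-above : (a : Fin n) (r : Fin (suc n)) → toℕ (fsuc a) < toℕ r → swap a r ≡ r
swap-fixes-above a r 1+a<r = swap-fixes a r (λ r≡a → <-irrefl (sym r≡a) (<-trans (n<1+n _) 1+a<r))
                                            (λ r≡1+a → <-irrefl (sym r≡1+a) 1+a<r)

swap-monotone : (a : Fin n) (p q : Fin (suc n)) → toℕ p < toℕ q →
                ¬ (p ≡ inject₁ a × q ≡ fsuc a) → toℕ (swap a p) < toℕ (swap a q)
swap-monotone fzero    fzero               (fsuc fzero)        _ h = ⊥-elim (h (refl , refl))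
swap-monotone fzero    fzero               (fsuc (fsuc q))     _ _ = s≤s (s≤s z≤n)
swap-monotone fzero    (fsuc fzero)        (fsuc (fsuc q))     _ _ = s≤s z≤n
swap-monotone fzero    (fsuc fzero)        (fsuc fzero) (s≤s ()) _
swap-monotone fzero    (fsuc (fsuc p))     (fsuc (fsuc q))    lt _ = lt
swap-monotone fzero    (fsuc (fsuc p))     (fsuc fzero) (s≤s ()) _
swap-monotone (fsuc a) fzero               (fsuc q)            _ _ = s≤s z≤n
swap-monotone (fsuc a) (fsuc p)            (fsuc q)     (s≤s lt) h =
  s≤s (swap-monotone a p q lt (λ (e₁ , e₂) → h (cong fsuc e₁ , cong fsuc e₂)))

is-swapped-pair? : (a : Fin n) (p q : Fin (suc n)) → Dec (p ≡ inject₁ a × q ≡ fsuc a)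
is-swapped-pair? a p q = p Finₚ.≟ inject₁ a ×-dec q Finₚ.≟ fsuc a

swap-preserves-side : (a : Fin n) (k : ℕ) (t : Fin (suc n)) → k ≢ toℕ a →
                      (toℕ t ≤ k → toℕ (swap a t) ≤ k) × (k < toℕ t → k < toℕ (swap a t))
swap-preserves-side a k t k≢a with swapView a t
... | left  rewrite swap-inject₁ a | Finₚ.toℕ-inject₁ a =
  (λ a≤k → ≤∧≢⇒< a≤k (k≢a ∘ sym)) , (λ k<a → <-trans k<a (n<1+n _))
... | right rewrite swap-suc a | Finₚ.toℕ-inject₁ a =
  (λ a<k → <⇒≤ a<k) , (λ k<1+a → ≤∧≢⇒< (s≤s⁻¹ k<1+a) k≢a)
... | fixed e rewrite e = (λ t≤k → t≤k) , (λ k<t → k<t)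

-- Inversions and reduced words

indicator : Bool → ℕ
indicator true  = 1
indicator false = 0

countBelow : ℕ → (Fin m → ℕ) → ℕ
countBelow {zero}  x h = 0
countBelow {suc m} x h = indicator ⌊ h fzero <? x ⌋ + countBelow x (h ∘ fsuc)

inversions : (Fin m → ℕ) → ℕ
inversions {zero}  h = 0
inversions {suc m} h = countBelow (h fzero) (h ∘ fsuc) + inversions (h ∘ fsuc)

countBelow-cong : ∀ x {h h′ : Fin m → ℕ} → h ≗ h′ → countBelow x h ≡ countBelow x h′
countBelow-cong {zero}  x e = refl
countBelow-cong {suc m} x e =
  cong₂ _+_ (cong (λ v → indicator ⌊ v <? x ⌋) (e fzero)) (countBelow-cong x (e ∘ fsuc))

inversions-cong : {h h′ : Fin m → ℕ} → h ≗ h′ → inversions h ≡ inversions h′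
inversions-cong {zero}  e = refl
inversions-cong {suc m} {h} {h′} e =
  cong₂ _+_ (trans (cong (λ v → countBelow v (h ∘ fsuc)) (e fzero)) (countBelow-cong (h′ fzero) (e ∘ fsuc)))
            (inversions-cong (e ∘ fsuc))

indicator-yes : ∀ {u v} → u < v → indicator ⌊ u <? v ⌋ ≡ 1
indicator-yes {u} {v} u<v with u <? v
... | yes _   = refl
... | no u≮v = ⊥-elim (u≮v u<v)

indicator-no : ∀ {u v} → ¬ u < v → indicator ⌊ u <? v ⌋ ≡ 0
indicator-no {u} {v} u≮v with u <? v
... | yes u<v = ⊥-elim (u≮v u<v)
... | no _    = refl

countBelow-∘swap : ∀ x (h : Fin (suc m) → ℕ) (a : Fin m) → countBelow x (h ∘ swap a) ≡ countBelow x h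
countBelow-∘swap {suc m} x h fzero =
  +-exchange (indicator ⌊ h (fsuc fzero) <? x ⌋) (indicator ⌊ h fzero <? x ⌋) (countBelow x (h ∘ fsuc ∘ fsuc))
countBelow-∘swap x h (fsuc a) = cong (indicator ⌊ h fzero <? x ⌋ +_) (countBelow-∘swap x (h ∘ fsuc) a)

inversions-∘swap-ascent : (h : Fin (suc m) → ℕ) (a : Fin m) → h (inject₁ a) < h (fsuc a) →
                          inversions (h ∘ swap a) ≡ suc (inversions h)
inversions-∘swap-ascent {suc m} h fzero asc
  rewrite indicator-yes asc | indicator-no (<⇒≯ asc) =
  cong suc (+-exchange (countBelow (h (fsuc fzero)) (h ∘ fsuc ∘ fsuc))
                       (countBelow (h fzero) (h ∘ fsuc ∘ fsuc)) _)
inversions-∘swap-ascent h (fsuc a) asc =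
  trans (cong₂ _+_ (countBelow-∘swap (h fzero) (h ∘ fsuc) a) (inversions-∘swap-ascent (h ∘ fsuc) a asc))
        (+-suc _ _)

inversions-∘swap-tie : (h : Fin (suc m) → ℕ) (a : Fin m) → h (inject₁ a) ≡ h (fsuc a) →
                       inversions (h ∘ swap a) ≡ inversions h
inversions-∘swap-tie h a tie = inversions-cong swapped≗h
  where
  swapped≗h : h ∘ swap a ≗ h
  swapped≗h k with swapView a k
  ... | left    = trans (cong h (swap-inject₁ a)) (sym tie)
  ... | right   = trans (cong h (swap-suc a)) tie
  ... | fixed e = cong h e

inversions-∘swap-descent : (h : Fin (suc m) → ℕ) (a : Fin m) → h (fsuc a) < h (inject₁ a) →
                           inversions h ≡ suc (inversions (h ∘ swap a))
inversions-∘swap-descent h a desc =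
  trans (sym (inversions-cong (cong h ∘ swap-involutive a)))
        (inversions-∘swap-ascent (h ∘ swap a) a
          (subst₂ _<_ (cong h (sym (swap-inject₁ a))) (cong h (sym (swap-suc a))) desc))

inversions-∘swap-≤ : (h : Fin (suc m) → ℕ) (a : Fin m) → inversions (h ∘ swap a) ≤ suc (inversions h)
inversions-∘swap-≤ h a with <-cmp (h (inject₁ a)) (h (fsuc a))
... | tri< asc _ _  = ≤-reflexive (inversions-∘swap-ascent h a asc)
... | tri≈ _ tie _  = ≤-trans (≤-reflexive (inversions-∘swap-tie h a tie)) (n≤1+n _)
... | tri> _ _ desc =
  ≤-trans (n≤1+n _) (≤-trans (≤-reflexive (sym (inversions-∘swap-descent h a desc))) (n≤1+n _))

countBelow-≤-all : ∀ x (h : Fin m → ℕ) → (∀ j → x ≤ h j) → countBelow x h ≡ 0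
countBelow-≤-all {zero}  x h x≤h = refl
countBelow-≤-all {suc m} x h x≤h rewrite indicator-no (≤⇒≯ (x≤h fzero)) =
  countBelow-≤-all x (h ∘ fsuc) (x≤h ∘ fsuc)

inversions-increasing : (h : Fin m → ℕ) → (∀ p q → toℕ p < toℕ q → h p < h q) → inversions h ≡ 0
inversions-increasing {zero}  h inc = refl
inversions-increasing {suc m} h inc
  rewrite countBelow-≤-all (h fzero) (h ∘ fsuc) (λ j → <⇒≤ (inc fzero (fsuc j) (s≤s z≤n))) =
  inversions-increasing (h ∘ fsuc) (λ p q lt → inc (fsuc p) (fsuc q) (s≤s lt))

Endo : ℕ → Set
Endo n = Fin (suc n) → Fin (suc n)

inv : Endo n → ℕ
inv f = inversions (toℕ ∘ f)

inv-cong : {f f′ : Endo n} → f ≗ f′ → inv f ≡ inv f′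
inv-cong e = inversions-cong (cong toℕ ∘ e)

inv-id : inv {n} id ≡ 0
inv-id {n} = inversions-increasing {suc n} toℕ (λ _ _ lt → lt)

inv-∘sFn : (g : Endo n) (a : Fin n) → inv (g ∘ sFn a) ≡ inversions (toℕ ∘ g ∘ swap a)
inv-∘sFn g a = inversions-cong (cong (toℕ ∘ g) ∘ sFn≗swap a)

inv-∘sFn-≤ : (g : Endo n) (a : Fin n) → inv (g ∘ sFn a) ≤ suc (inv g)
inv-∘sFn-≤ g a = ≤-trans (≤-reflexive (inv-∘sFn g a)) (inversions-∘swap-≤ (toℕ ∘ g) a)

eval-++ : (xs ys : Word n) → eval (xs ++ ys) ≗ eval xs ∘ eval ys
eval-++ []       ys k = refl
eval-++ (x ∷ xs) ys k = cong (sFn x) (eval-++ xs ys k)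

sFn-involutive : (a : Fin n) → sFn a ∘ sFn a ≗ id
sFn-involutive a k = trans (sFn≗swap a _) (trans (cong (swap a) (sFn≗swap a k)) (swap-involutive a k))

sFn-inject₁ : (a : Fin n) → sFn a (inject₁ a) ≡ fsuc a
sFn-inject₁ a = trans (sFn≗swap a _) (swap-inject₁ a)

sFn-suc : (a : Fin n) → sFn a (fsuc a) ≡ inject₁ a
sFn-suc a = trans (sFn≗swap a _) (swap-suc a)

sFn-injective : (a : Fin n) → Injective _≡_ _≡_ (sFn a)
sFn-injective a {x} {y} e = trans (sym (sFn-involutive a x)) (trans (cong (sFn a) e) (sFn-involutive a y))

eval-injective : (ws : Word n) → Injective _≡_ _≡_ (eval ws)
eval-injective []       e = e
eval-injective (a ∷ as) e = eval-injective as (sFn-injective a e)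

inv-∘eval-≤ : (g : Endo n) (ws : Word n) → inv (g ∘ eval ws) ≤ inv g + length ws
inv-∘eval-≤ g []       = ≤-reflexive (sym (+-identityʳ _))
inv-∘eval-≤ g (a ∷ as) = begin
  inv (g ∘ sFn a ∘ eval as)   ≤⟨ inv-∘eval-≤ (g ∘ sFn a) as ⟩
  inv (g ∘ sFn a) + length as ≤⟨ +-monoˡ-≤ (length as) (inv-∘sFn-≤ g a) ⟩
  suc (inv g) + length as     ≡⟨ +-suc (inv g) (length as) ⟨
  inv g + length (a ∷ as)     ∎
  where open ≤-Reasoning

inv-eval-≤ : (ws : Word n) → inv (eval ws) ≤ length ws
inv-eval-≤ {n} ws = subst (λ k → inv (eval ws) ≤ k + length ws) (inv-id {n}) (inv-∘eval-≤ id ws)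

LengthAdditive : Endo n → Word n → Set
LengthAdditive g ws = inv (g ∘ eval ws) ≡ inv g + length ws

length-additive-∷ : (g : Endo n) (a : Fin n) (as : Word n) → LengthAdditive g (a ∷ as) →
                    inv (g ∘ sFn a) ≡ suc (inv g) × LengthAdditive (g ∘ sFn a) as
length-additive-∷ g a as additive =
  head-step , trans additive (trans (+-suc (inv g) (length as)) (cong (_+ length as) (sym head-step)))
  where
  head-step : inv (g ∘ sFn a) ≡ suc (inv g)
  head-step = ≤-antisym (inv-∘sFn-≤ g a) (+-cancelʳ-≤ (length as) _ _ (begin
    suc (inv g) + length as     ≡⟨ +-suc (inv g) (length as) ⟨
    inv g + length (a ∷ as)     ≡⟨ additive ⟨
    inv (g ∘ sFn a ∘ eval as)   ≤⟨ inv-∘eval-≤ (g ∘ sFn a) as ⟩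
    inv (g ∘ sFn a) + length as ∎))
    where open ≤-Reasoning

inv-∘sFn-descent : (g : Endo n) (a : Fin n) → toℕ (g (fsuc a)) < toℕ (g (inject₁ a)) →
                   inv g ≡ suc (inv (g ∘ sFn a))
inv-∘sFn-descent g a desc = trans (inversions-∘swap-descent (toℕ ∘ g) a desc) (cong suc (sym (inv-∘sFn g a)))

inv-∘sFn-ascent : (g : Endo n) (a : Fin n) → toℕ (g (inject₁ a)) < toℕ (g (fsuc a)) →
                  inv (g ∘ sFn a) ≡ suc (inv g)
inv-∘sFn-ascent g a asc = trans (inv-∘sFn g a) (inversions-∘swap-ascent (toℕ ∘ g) a asc)

inv-∘sFn≡suc⇒ascent : (g : Endo n) (a : Fin n) → inv (g ∘ sFn a) ≡ suc (inv g) →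
                       toℕ (g (inject₁ a)) < toℕ (g (fsuc a))
inv-∘sFn≡suc⇒ascent g a e with <-cmp (toℕ (g (inject₁ a))) (toℕ (g (fsuc a)))
... | tri< asc _ _  = asc
... | tri≈ _ tie _  =
  ⊥-elim (1+n≢n (trans (sym e) (trans (inv-∘sFn g a) (inversions-∘swap-tie (toℕ ∘ g) a tie))))
... | tri> _ _ desc =
  ⊥-elim (<-irrefl (trans (inv-∘sFn-descent g a desc) (cong suc e)) (m<n⇒m<1+n (n<1+n (inv g))))

ascending⇒≗id : (f : Endo n) → (∀ a → toℕ (f (inject₁ a)) < toℕ (f (fsuc a))) → f ≗ id
ascending⇒≗id {n} f asc p = Finₚ.toℕ-injective (≤-antisym (below p) (above p))
  where
  above : ∀ p → toℕ p ≤ toℕ (f p)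
  above = <-weakInduction (λ p → toℕ p ≤ toℕ (f p)) z≤n
    (λ i ih → ≤-trans (s≤s (subst (_≤ toℕ (f (inject₁ i))) (Finₚ.toℕ-inject₁ i) ih)) (asc i))
  below : ∀ p → toℕ (f p) ≤ toℕ p
  below = >-weakInduction (λ p → toℕ (f p) ≤ toℕ p)
    (subst (toℕ (f (fromℕ n)) ≤_) (sym (Finₚ.toℕ-fromℕ n)) (Finₚ.toℕ≤pred[n] (f (fromℕ n))))
    (λ i ih → subst (toℕ (f (inject₁ i)) ≤_) (sym (Finₚ.toℕ-inject₁ i)) (s≤s⁻¹ (≤-trans (asc i) ih)))

no-descent⇒≗id : (f : Endo n) → Injective _≡_ _≡_ f →
                 ¬ (∃ λ a → toℕ (f (fsuc a)) < toℕ (f (inject₁ a))) → f ≗ id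
no-descent⇒≗id f inj none = ascending⇒≗id f λ a → ≤∧≢⇒< (≮⇒≥ (λ desc → none (a , desc))) (no-tie a)
  where
  no-tie : ∀ a → toℕ (f (inject₁ a)) ≢ toℕ (f (fsuc a))
  no-tie a e = inject₁≢suc a (inj (Finₚ.toℕ-injective e))

-- Bubble sort: undo a descent and recurse; each step removes one inversion.
word-of-length-inv : (f : Endo n) → Injective _≡_ _≡_ f →
                     Σ (Word n) λ ws → eval ws ≗ f × length ws ≡ inv f
word-of-length-inv {n} f inj = sort (inv f) f inj refl
  where
  -- k = inv f makes the recursion structural.
  sort : ∀ k (f : Endo n) → Injective _≡_ _≡_ f → inv f ≡ k →
         Σ (Word n) λ ws → eval ws ≗ f × length ws ≡ inv f
  sort k f inj e with Finₚ.any? (λ a → toℕ (f (fsuc a)) <? toℕ (f (inject₁ a)))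
  ... | no none = [] , sym ∘ f≗id , trans (sym (inv-id {n})) (sym (inv-cong f≗id))
    where
    f≗id : f ≗ id
    f≗id = no-descent⇒≗id f inj none
  ... | yes (a , desc) with k | trans (sym e) (inv-∘sFn-descent f a desc)
  ...   | zero  | ()
  ...   | suc k | e′ with sort k (f ∘ sFn a) (sFn-injective a ∘ inj) (suc-injective (sym e′))
  ...     | ws , ws≗f∘a , len = ws ++ a ∷ [] , ws∷a≗f , length-snoc
    where
    ws∷a≗f : eval (ws ++ a ∷ []) ≗ f
    ws∷a≗f x = trans (eval-++ ws (a ∷ []) x) (trans (ws≗f∘a (sFn a x)) (cong f (sFn-involutive a x)))
    length-snoc : length (ws ++ a ∷ []) ≡ inv f
    length-snoc = begin
      length (ws ++ a ∷ [])   ≡⟨ length-++ ws ⟩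
      length ws + 1           ≡⟨ +-comm (length ws) 1 ⟩
      suc (length ws)         ≡⟨ cong suc len ⟩
      suc (inv (f ∘ sFn a))   ≡⟨ inv-∘sFn-descent f a desc ⟨
      inv f                   ∎
      where open ≡-Reasoning

⟨$⟩ʳ-injective : (w : Perm n) → Injective _≡_ _≡_ (w ⟨$⟩ʳ_)
⟨$⟩ʳ-injective w {x} {y} e = trans (sym (inverseˡ w)) (trans (cong (w ⟨$⟩ˡ_) e) (inverseˡ w))

IsReduced⇒length≡inv : (ws : Word n) (w : Perm n) → IsReduced ws w → length ws ≡ inv (w ⟨$⟩ʳ_)
IsReduced⇒length≡inv ws w (ws≗w , minimal) with word-of-length-inv (w ⟨$⟩ʳ_) (⟨$⟩ʳ-injective w)
... | vs , vs≗w , len =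
  ≤-antisym (≤-trans (minimal vs vs≗w) (≤-reflexive len))
            (≤-trans (≤-reflexive (inv-cong (sym ∘ ws≗w))) (inv-eval-≤ ws))

length≤inv⇒IsReduced : (ws : Word n) (w : Perm n) → IsWordFor ws w → length ws ≤ inv (w ⟨$⟩ʳ_) →
                       IsReduced ws w
length≤inv⇒IsReduced ws w ws≗w short = ws≗w , λ vs vs≗w →
  ≤-trans short (≤-trans (≤-reflexive (inv-cong (sym ∘ vs≗w))) (inv-eval-≤ vs))

Before : Endo n → Fin (suc n) → Fin (suc n) → Set
Before g α β = Σ _ λ p → Σ _ λ q → toℕ p < toℕ q × g p ≡ α × g q ≡ β

-- Each letter of a reduced continuation swaps an ascent, so an inverted pair of values stays inverted.
inversion-persists : (g : Endo n) (vs : Word n) → LengthAdditive g vs →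
                     ∀ {α β} → toℕ β < toℕ α → Before g α β → Before (g ∘ eval vs) α β
inversion-persists g []       _        _   before = before
inversion-persists g (a ∷ as) additive β<α (p , q , p<q , gp , gq) =
  inversion-persists (g ∘ sFn a) as (proj₂ step) β<α
    (swap a p , swap a q , swap-monotone a p q p<q not-ascent , value-at p gp , value-at q gq)
  where
  step : inv (g ∘ sFn a) ≡ suc (inv g) × LengthAdditive (g ∘ sFn a) as
  step = length-additive-∷ g a as additive
  not-ascent : ¬ (p ≡ inject₁ a × q ≡ fsuc a)
  not-ascent (refl , refl) =
    <-asym β<α (subst₂ (λ x y → toℕ x < toℕ y) gp gq (inv-∘sFn≡suc⇒ascent g a (proj₁ step)))
  value-at : ∀ t {x} → g t ≡ x → g (sFn a (swap a t)) ≡ x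
  value-at t gt = trans (cong g (trans (sFn≗swap a _) (swap-involutive a t))) gt

-- Sortable permutations avoid 312

Occurs312 : Endo n → (p q r : Fin (suc n)) → Set
Occurs312 g p q r = toℕ p < toℕ q × toℕ q < toℕ r × toℕ (g q) < toℕ (g r) × toℕ (g r) < toℕ (g p)

Occurs132 : Endo n → (p q r : Fin (suc n)) → Set
Occurs132 g p q r = toℕ p < toℕ q × toℕ q < toℕ r × toℕ (g p) < toℕ (g r) × toℕ (g r) < toℕ (g q)

Avoids312 : Endo n → Set
Avoids312 g = ∀ p q r → ¬ Occurs312 g p q r

Avoids132 : Endo n → Set
Avoids132 g = ∀ p q r → ¬ Occurs132 g p q r

<-cong : {f g : Endo n} → f ≗ g → ∀ {p q} → toℕ (f p) < toℕ (f q) → toℕ (g p) < toℕ (g q)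
<-cong f≗g {p} {q} = subst₂ (λ x y → toℕ x < toℕ y) (f≗g p) (f≗g q)

Occurs312-cong : {f g : Endo n} → f ≗ g → ∀ {p q r} → Occurs312 f p q r → Occurs312 g p q r
Occurs312-cong f≗g (p<q , q<r , fq<fr , fr<fp) = p<q , q<r , <-cong f≗g fq<fr , <-cong f≗g fr<fp

Occurs132-cong : {f g : Endo n} → f ≗ g → ∀ {p q r} → Occurs132 f p q r → Occurs132 g p q r
Occurs132-cong f≗g (p<q , q<r , fp<fr , fr<fq) = p<q , q<r , <-cong f≗g fp<fr , <-cong f≗g fr<fq

-- Swapping an ascent can only create a 312 from a 132 whose first two entries are the swapped ones.
avoids312-∘swap : (g : Endo n) (a : Fin n) → toℕ (g (inject₁ a)) < toℕ (g (fsuc a)) →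
                  (∀ r → ¬ Occurs132 g (inject₁ a) (fsuc a) r) → Avoids312 g → Avoids312 (g ∘ swap a)
avoids312-∘swap g a asc no132 avoids p q r (p<q , q<r , gq<gr , gr<gp)
  with is-swapped-pair? a p q | is-swapped-pair? a q r
... | yes (refl , refl) | _ rewrite swap-inject₁ a | swap-suc a | swap-fixes-above a r q<r =
  no132 r (p<q , q<r , gq<gr , gr<gp)
... | no _ | yes (refl , refl) rewrite swap-inject₁ a | swap-suc a = <-asym asc gq<gr
... | no ¬pq | no ¬qr =
  avoids (swap a p) (swap a q) (swap a r) (swap-monotone a p q p<q ¬pq , swap-monotone a q r q<r ¬qr , gq<gr , gr<gp)

WallBetween : List (Pos n) → (p q : Fin (suc n)) → Set
WallBetween rest p q = Σ _ λ k → toℕ p ≤ toℕ k × toℕ k < toℕ q × k ∉ letters rest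

-- (p , a′ , a′ + 1) is a 132, and its wall also separates p from a′ + 1.
walled-before-descent : ∀ {rest} (g : Endo n) → (∀ p q r → Occurs132 g p q r → WallBetween rest p q) →
                        ∀ a′ → toℕ (g (fsuc a′)) < toℕ (g (inject₁ a′)) →
                        ∀ p → toℕ p < toℕ (fsuc a′) → toℕ (g p) < toℕ (g (fsuc a′)) → WallBetween rest p (fsuc a′)
walled-before-descent g walls a′ desc p p<a gp<ga with m≤n⇒m<n∨m≡n (s≤s⁻¹ p<a) | Finₚ.toℕ-inject₁ a′
... | inj₂ p≡a′ | ι rewrite Finₚ.toℕ-injective {i = p} {j = inject₁ a′} (trans p≡a′ (sym ι)) =
  ⊥-elim (<-asym gp<ga desc)
... | inj₁ p<a′ | ι
  with walls p (inject₁ a′) (fsuc a′)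
             (subst (toℕ p <_) (sym ι) p<a′ , subst (_< suc (toℕ a′)) (sym ι) (n<1+n _) , gp<ga , desc)
...   | k , p≤k , k<a′ , k∉ = k , p≤k , <-trans (subst (toℕ k <_) ι k<a′) (n<1+n _) , k∉

<P-trans : {x y z : Pos n} → x <P y → y <P z → x <P z
<P-trans (inj₁ j<j′)        (inj₁ j′<j″)       = inj₁ (<-trans j<j′ j′<j″)
<P-trans (inj₁ j<j′)        (inj₂ (refl , _))  = inj₁ j<j′
<P-trans (inj₂ (refl , _))  (inj₁ j′<j″)       = inj₁ j′<j″
<P-trans (inj₂ (refl , k<k′)) (inj₂ (refl , k′<k″)) = inj₂ (refl , <-trans k<k′ k′<k″)

<P⇒copy< : ∀ {j j′} {k k′ : Fin n} → (j , k) <P (j′ , k′) → toℕ k′ < toℕ k → j < j′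
<P⇒copy< (inj₁ j<j′)       _     = j<j′
<P⇒copy< (inj₂ (_ , k<k′)) k′<k = ⊥-elim (<-asym k<k′ k′<k)

increasing-tail : ∀ {x : Pos n} {xs} → Increasing (x ∷ xs) → Increasing xs
increasing-tail (inc[-] _)  = inc[]
increasing-tail (inc∷ _ xs) = xs

increasing-head : ∀ {x y : Pos n} {xs} → Increasing (x ∷ xs) → y ∈ xs → x <P y
increasing-head (inc∷ x<y _)  (here refl) = x<y
increasing-head (inc∷ x<x′ xs) (there y∈) = <P-trans x<x′ (increasing-head xs y∈)

increasing-++⁻ʳ : (xs : List (Pos n)) {ys : List (Pos n)} → Increasing (xs ++ ys) → Increasing ys
increasing-++⁻ʳ []       inc = inc
increasing-++⁻ʳ (x ∷ xs) inc = increasing-++⁻ʳ xs (increasing-tail inc)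

increasing-++-before : (xs : List (Pos n)) {y t : Pos n} {ys : List (Pos n)} →
                       Increasing (xs ++ y ∷ ys) → t ∈ xs → t <P y
increasing-++-before (x ∷ xs) inc (here refl) = increasing-head inc (∈-++⁺ʳ xs (here refl))
increasing-++-before (x ∷ xs) inc (there t∈)  = increasing-++-before xs (increasing-tail inc) t∈

last-of-prefix : (xs : List (Pos n)) {y z : Pos n} {ys : List (Pos n)} → Increasing (xs ++ y ∷ ys) → z ∈ xs →
                 (∀ t → z <P t → t <P y → ⊥) → ∃ λ xs₀ → xs ≡ xs₀ ∷ʳ z
last-of-prefix (x ∷ [])      inc (here refl) nothing-between = [] , refl
last-of-prefix (x ∷ x′ ∷ xs) inc (here refl) nothing-between =
  ⊥-elim (nothing-between x′ (increasing-head inc (here refl))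
                             (increasing-++-before (x′ ∷ xs) (increasing-tail inc) (here refl)))
last-of-prefix (x ∷ xs)      inc (there z∈)  nothing-between
  with last-of-prefix xs (increasing-tail inc) z∈ nothing-between
... | xs₀ , refl = x ∷ xs₀ , refl

nested-≤ : {ps : List (Pos n)} → Nested ps → ∀ {j j′ k} → j ≤ j′ → (j′ , k) ∈ ps → (j , k) ∈ ps
nested-≤ nest {j} {zero}   z≤n   k∈ = k∈
nested-≤ nest {j} {suc j′} j≤1+j′ k∈ with m≤n⇒m<n∨m≡n j≤1+j′
... | inj₂ refl        = k∈
... | inj₁ (s≤s j≤j′) = nested-≤ nest j≤j′ (nest j′ _ k∈)

module SortingWord {ps : List (Pos n)} (increasing : Increasing ps) (nested : Nested ps) where

  open DecMembership (Finₚ._≟_ {n}) using (_∈?_)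

  -- A letter a′ = a - 1 occurring after (j , a) occurs in copy j as well, by nestedness, hence just before (j , a).
  predecessor-precedes : ∀ done j (a′ a : Fin n) rest → ps ≡ done ++ (j , a) ∷ rest → suc (toℕ a′) ≡ toℕ a →
                         a′ ∈ letters rest → ∃ λ done₀ → done ≡ done₀ ∷ʳ (j , a′)
  predecessor-precedes done j a′ a rest refl 1+a′≡a a′∈ with ∈-map⁻ proj₂ a′∈
  ... | (j″ , _) , later∈ , refl
    with ∈-++⁻ done (nested-≤ nested (<⇒≤ (<P⇒copy< (increasing-head (increasing-++⁻ʳ done increasing) later∈)
                                                     (≤-reflexive 1+a′≡a)))
                                     (∈-++⁺ʳ done (there later∈)))
  ... | inj₁ in-done     = last-of-prefix done increasing in-done nothing-between
    where
    nothing-between : ∀ t → (j , a′) <P t → t <P (j , a) → ⊥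
    nothing-between t (inj₁ j<jₜ)        (inj₁ jₜ<j)       = <-asym j<jₜ jₜ<j
    nothing-between t (inj₁ j<j)         (inj₂ (refl , _)) = <-irrefl refl j<j
    nothing-between t (inj₂ (refl , _))  (inj₁ j<j)        = <-irrefl refl j<j
    nothing-between t (inj₂ (_ , a′<kₜ)) (inj₂ (_ , kₜ<a)) =
      ≤⇒≯ (s≤s⁻¹ (subst (toℕ (proj₂ t) <_) (sym 1+a′≡a) kₜ<a)) a′<kₜ
  ... | inj₂ (here a′≡a) = ⊥-elim (1+n≢n (trans 1+a′≡a (cong (toℕ ∘ proj₂) (sym a′≡a))))
  ... | inj₂ (there later) = ⊥-elim (<-irrefl refl
    (<P⇒copy< (increasing-head (increasing-++⁻ʳ done increasing) later) (≤-reflexive 1+a′≡a)))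

  -- g is the product of the letters in done.  The letters still to come never exchange the positions
  -- k and k + 1 of a wall k, so they cannot move the 3 of a walled 132 in front of its 1.  The descent
  -- left by the last letter of done supplies the walls of the 132s created by the next letter.
  record Invariant (g : Endo n) (done rest : List (Pos n)) : Set where
    field
      avoids312    : Avoids312 g
      walls        : ∀ p q r → Occurs132 g p q r → WallBetween rest p q
      last-descent : ∀ done₀ x → done ≡ done₀ ∷ʳ x →
                     toℕ (g (fsuc (proj₂ x))) < toℕ (g (inject₁ (proj₂ x)))
  open Invariant

  invariant-cong : {f g : Endo n} → f ≗ g → ∀ {done rest} → Invariant f done rest → Invariant g done rest
  invariant-cong f≗g I = record
    { avoids312    = λ p q r → avoids312 I p q r ∘ Occurs312-cong (sym ∘ f≗g)
    ; walls        = λ p q r → walls I p q r ∘ Occurs132-cong (sym ∘ f≗g)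
    ; last-descent = λ done₀ x e → <-cong f≗g (last-descent I done₀ x e)
    }

  invariant-start : Invariant id [] ps
  invariant-start = record
    { avoids312    = λ { p q r (p<q , q<r , _ , r<p) → <-asym (<-trans p<q q<r) r<p }
    ; walls        = λ { p q r (_ , q<r , _ , r<q) → ⊥-elim (<-asym q<r r<q) }
    ; last-descent = λ { [] x () ; (_ ∷ _) x () }
    }

  new-wall : ∀ done j (a : Fin n) rest (g : Endo n) → ps ≡ done ++ (j , a) ∷ rest →
             Invariant g done ((j , a) ∷ rest) →
             ∀ p → toℕ p < toℕ (inject₁ a) → toℕ (g p) < toℕ (g (inject₁ a)) → WallBetween rest p (inject₁ a)
  new-wall done j fzero    rest g eq I p () gp<ga
  new-wall done j (fsuc b) rest g eq I p p<a gp<ga with inject₁ b ∈? letters rest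
  ... | no a′∉ = inject₁ b , s≤s⁻¹ p<a , n<1+n _ , a′∉
  ... | yes a′∈
    with predecessor-precedes done j (inject₁ b) (fsuc b) rest eq (cong suc (Finₚ.toℕ-inject₁ b)) a′∈
  ...   | done₀ , done≡
    with walled-before-descent {rest = (j , fsuc b) ∷ rest} g (walls I) (inject₁ b)
                               (last-descent I done₀ (j , inject₁ b) done≡) p p<a gp<ga
  ...     | k , p≤k , k<a , k∉ = k , p≤k , k<a , k∉ ∘ there

  invariant-step : ∀ done j (a : Fin n) rest (g : Endo n) → ps ≡ done ++ (j , a) ∷ rest →
                   toℕ (g (inject₁ a)) < toℕ (g (fsuc a)) → Invariant g done ((j , a) ∷ rest) →
                   Invariant (g ∘ swap a) (done ∷ʳ (j , a)) rest
  invariant-step done j a rest g eq asc I = record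
    { avoids312    = avoids312-∘swap g a asc a-unwalled (avoids312 I)
    ; walls        = walls′
    ; last-descent = last-descent′
    }
    where
    a-unwalled : ∀ r → ¬ Occurs132 g (inject₁ a) (fsuc a) r
    a-unwalled r occ with walls I _ _ r occ
    ... | k , a≤k , k<1+a , k∉ =
      k∉ (here (Finₚ.toℕ-injective (≤-antisym (s≤s⁻¹ k<1+a) (subst (_≤ toℕ k) (Finₚ.toℕ-inject₁ a) a≤k))))

    walls′ : ∀ p q r → Occurs132 (g ∘ swap a) p q r → WallBetween rest p q
    walls′ p q r (p<q , q<r , gp<gr , gr<gq) with is-swapped-pair? a p q | is-swapped-pair? a q r
    ... | yes (refl , refl) | _ rewrite swap-inject₁ a | swap-suc a | swap-fixes-above a r q<r =
      ⊥-elim (<-asym asc (<-trans gp<gr gr<gq))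
    ... | no _ | yes (refl , refl) rewrite swap-inject₁ a | swap-suc a | swap-fixes-below a p p<q =
      new-wall done j a rest g eq I p p<q gp<gr
    ... | no ¬pq | no ¬qr
      with walls I (swap a p) (swap a q) (swap a r)
                 (swap-monotone a p q p<q ¬pq , swap-monotone a q r q<r ¬qr , gp<gr , gr<gq)
    ...   | k , p≤k , k<q , k∉ =
      k , subst (λ x → toℕ x ≤ toℕ k) (swap-involutive a p)
                (proj₁ (swap-preserves-side a (toℕ k) (swap a p) k≢a) p≤k)
        , subst (λ x → toℕ k < toℕ x) (swap-involutive a q)
                (proj₂ (swap-preserves-side a (toℕ k) (swap a q) k≢a) k<q)
        , k∉ ∘ there
      where
      k≢a : toℕ k ≢ toℕ a
      k≢a k≡a = k∉ (here (Finₚ.toℕ-injective k≡a))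

    last-descent′ : ∀ done₀ x → done ∷ʳ (j , a) ≡ done₀ ∷ʳ x →
                    toℕ (g (swap a (fsuc (proj₂ x)))) < toℕ (g (swap a (inject₁ (proj₂ x))))
    last-descent′ done₀ x e rewrite sym (∷ʳ-injectiveʳ done done₀ e) | swap-suc a | swap-inject₁ a = asc

  avoids312-after : ∀ done rest (g : Endo n) → ps ≡ done ++ rest → LengthAdditive g (letters rest) →
                    Invariant g done rest → Avoids312 (g ∘ eval (letters rest))
  avoids312-after done []             g _  _        I = avoids312 I
  avoids312-after done ((j , a) ∷ rest) g eq additive I =
    avoids312-after (done ∷ʳ (j , a)) rest (g ∘ sFn a) (trans eq (sym (∷ʳ-++ done (j , a) rest))) (proj₂ step)
      (invariant-cong (cong g ∘ sym ∘ sFn≗swap a)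
        (invariant-step done j a rest g eq (inv-∘sFn≡suc⇒ascent g a (proj₁ step)) I))
    where
    step : inv (g ∘ sFn a) ≡ suc (inv g) × LengthAdditive (g ∘ sFn a) (letters rest)
    step = length-additive-∷ g a (letters rest) additive

sortable⇒avoids312 : (v : Perm n) → Sortable v → Avoids312 (v ⟨$⟩ʳ_)
sortable⇒avoids312 {n} v (ps , (increasing , reduced@(ps≗v , _) , _) , nested) p q r =
  avoids312-after [] ps id refl additive invariant-start p q r ∘ Occurs312-cong (sym ∘ ps≗v)
  where
  open SortingWord increasing nested
  additive : LengthAdditive id (letters ps)
  additive = begin
    inv (eval (letters ps))      ≡⟨ inv-cong ps≗v ⟩
    inv (v ⟨$⟩ʳ_)                 ≡⟨ IsReduced⇒length≡inv (letters ps) v reduced ⟨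
    length (letters ps)          ≡⟨ cong (_+ length (letters ps)) (inv-id {n}) ⟨
    inv {n} id + length (letters ps) ∎
    where open ≡-Reasoning

-- Singletons avoid 132

reduced-++⇒additive : (us vs : Word n) (u : Perm n) → IsReduced (us ++ vs) u → LengthAdditive (eval us) vs
reduced-++⇒additive us vs u reduced@(us++vs≗u , _) = ≤-antisym (inv-∘eval-≤ (eval us) vs) (begin
  inv (eval us) + length vs   ≤⟨ +-monoˡ-≤ (length vs) (inv-eval-≤ us) ⟩
  length us + length vs       ≡⟨ length-++ us ⟨
  length (us ++ vs)           ≡⟨ IsReduced⇒length≡inv (us ++ vs) u reduced ⟩
  inv (u ⟨$⟩ʳ_)                ≡⟨ inv-cong (λ k → trans (sym (us++vs≗u k)) (eval-++ us vs k)) ⟩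
  inv (eval us ∘ eval vs)     ∎)
  where open ≤-Reasoning

_·s_ : Perm n → Fin n → Perm n
w ·s i = permutation (λ k → w ⟨$⟩ʳ sFn i k) (λ k → sFn i (w ⟨$⟩ˡ k))
                     (λ k → trans (cong (w ⟨$⟩ʳ_) (sFn-involutive i _)) (inverseʳ w))
                     (λ k → trans (cong (sFn i) (inverseˡ w)) (sFn-involutive i k))

module _ (w : Perm n) (i : Fin n) (asc : toℕ (w ⟨$⟩ʳ inject₁ i) < toℕ (w ⟨$⟩ʳ fsuc i)) where

  inv-·s : inv ((w ·s i) ⟨$⟩ʳ_) ≡ suc (inv (w ⟨$⟩ʳ_))
  inv-·s = inv-∘sFn-ascent (w ⟨$⟩ʳ_) i asc

  ≤R-·s : w ≤R (w ·s i)
  ≤R-·s with word-of-length-inv (w ⟨$⟩ʳ_) (⟨$⟩ʳ-injective w)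
  ... | ws , ws≗w , len = ws , i ∷ [] , length≤inv⇒IsReduced (ws ++ i ∷ []) (w ·s i) ws∷i≗ws·i short , ws≗w
    where
    ws∷i≗ws·i : IsWordFor (ws ++ i ∷ []) (w ·s i)
    ws∷i≗ws·i k = trans (eval-++ ws (i ∷ []) k) (ws≗w (sFn i k))
    short : length (ws ++ i ∷ []) ≤ inv ((w ·s i) ⟨$⟩ʳ_)
    short = ≤-reflexive (trans (length-++ ws) (trans (+-comm (length ws) 1) (trans (cong suc len) (sym inv-·s))))

  -- If a reduced factorisation us · vs of w s_i has vs descending at i, then s_i cancels into vs.
  below-·s-descent : ∀ (v′ : Perm n) us vs → IsReduced (us ++ vs) (w ·s i) → IsWordFor us v′ →
                     toℕ (eval vs (fsuc i)) < toℕ (eval vs (inject₁ i)) → v′ ≤R w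
  below-·s-descent v′ us vs reduced@(us++vs≗u , _) us≗v′ desc
    with word-of-length-inv (eval vs ∘ sFn i) (sFn-injective i ∘ eval-injective vs)
  ... | vs′ , vs′≗vs·i , len = us , vs′ , length≤inv⇒IsReduced (us ++ vs′) w us++vs′≗w short , us≗v′
    where
    us++vs′≗w : IsWordFor (us ++ vs′) w
    us++vs′≗w k = begin
      eval (us ++ vs′) k             ≡⟨ eval-++ us vs′ k ⟩
      eval us (eval vs′ k)           ≡⟨ cong (eval us) (vs′≗vs·i k) ⟩
      eval us (eval vs (sFn i k))    ≡⟨ eval-++ us vs (sFn i k) ⟨
      eval (us ++ vs) (sFn i k)      ≡⟨ us++vs≗u (sFn i k) ⟩
      w ⟨$⟩ʳ sFn i (sFn i k)          ≡⟨ cong (w ⟨$⟩ʳ_) (sFn-involutive i k) ⟩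
      w ⟨$⟩ʳ k                        ∎
      where open ≡-Reasoning
    short : length (us ++ vs′) ≤ inv (w ⟨$⟩ʳ_)
    short = s≤s⁻¹ (begin
      suc (length (us ++ vs′))            ≡⟨ cong suc (trans (length-++ us) (cong (length us +_) len)) ⟩
      suc (length us + inv (eval vs ∘ sFn i)) ≡⟨ +-suc (length us) _ ⟨
      length us + suc (inv (eval vs ∘ sFn i)) ≡⟨ cong (length us +_) (inv-∘sFn-descent (eval vs) i desc) ⟨
      length us + inv (eval vs)           ≤⟨ +-monoʳ-≤ (length us) (inv-eval-≤ vs) ⟩
      length us + length vs               ≡⟨ length-++ us ⟨
      length (us ++ vs)                   ≡⟨ IsReduced⇒length≡inv (us ++ vs) (w ·s i) reduced ⟩
      inv ((w ·s i) ⟨$⟩ʳ_)                 ≡⟨ inv-·s ⟩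
      suc (inv (w ⟨$⟩ʳ_))                  ∎)
      where open ≤-Reasoning

  module _ (r : Fin (suc n)) (lo : toℕ (w ⟨$⟩ʳ inject₁ i) < toℕ (w ⟨$⟩ʳ r))
           (hi : toℕ (w ⟨$⟩ʳ r) < toℕ (w ⟨$⟩ʳ fsuc i)) (i+1<r : suc (toℕ i) < toℕ r) where

    -- Otherwise us would contain the 312 formed by the values w(i+1), w(i), w(r).
    below-·s-no-ascent : ∀ (v′ : Perm n) us vs → IsReduced (us ++ vs) (w ·s i) → IsWordFor us v′ → Sortable v′ →
                         ¬ toℕ (eval vs (inject₁ i)) < toℕ (eval vs (fsuc i))
    below-·s-no-ascent v′ us vs reduced@(us++vs≗u , _) us≗v′ sortable X-asc =
      sortable⇒avoids312 v′ sortable (X (inject₁ i)) (X (fsuc i)) (X r)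
        (Occurs312-cong us≗v′ (X-asc , Xi+1<Xr , mid , top))
      where
      X G : Endo n
      X = eval vs
      G = eval us
      GX : ∀ k → G (X k) ≡ w ⟨$⟩ʳ sFn i k
      GX k = trans (sym (eval-++ us vs k)) (us++vs≗u k)
      GX-r : G (X r) ≡ w ⟨$⟩ʳ r
      GX-r = trans (GX r) (cong (w ⟨$⟩ʳ_) (trans (sFn≗swap i r) (swap-fixes-above i r i+1<r)))
      mid : toℕ (G (X (fsuc i))) < toℕ (G (X r))
      mid = subst₂ (λ x y → toℕ x < toℕ y)
              (sym (trans (GX (fsuc i)) (cong (w ⟨$⟩ʳ_) (sFn-suc i)))) (sym GX-r) lo
      top : toℕ (G (X r)) < toℕ (G (X (inject₁ i)))
      top = subst₂ (λ x y → toℕ x < toℕ y)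
              (sym GX-r) (sym (trans (GX (inject₁ i)) (cong (w ⟨$⟩ʳ_) (sFn-inject₁ i)))) hi
      Xi+1<Xr : toℕ (X (fsuc i)) < toℕ (X r)
      Xi+1<Xr with <-cmp (toℕ (X (fsuc i))) (toℕ (X r))
      ... | tri< lt _ _ = lt
      ... | tri≈ _ e _  = ⊥-elim (<-irrefl (cong toℕ (eval-injective vs (Finₚ.toℕ-injective e))) i+1<r)
      ... | tri> _ _ gt with inversion-persists G vs (reduced-++⇒additive us vs (w ·s i) reduced) mid
                               (X r , X (fsuc i) , gt , refl , refl)
      ...   | p′ , q′ , p′<q′ , e₁ , e₂ =
        ⊥-elim (<-asym i+1<r (subst₂ (λ x y → toℕ x < toℕ y) (GX-injective e₁) (GX-injective e₂) p′<q′))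
        where
        GX-injective : Injective _≡_ _≡_ (G ∘ X)
        GX-injective = eval-injective vs ∘ eval-injective us

    π↓-·s : Sortable w → IsPiDown (w ·s i) w
    π↓-·s sortable = sortable , ≤R-·s , largest
      where
      largest : ∀ v′ → Sortable v′ → v′ ≤R (w ·s i) → v′ ≤R w
      largest v′ sortable′ (us , vs , reduced , us≗v′)
        with <-cmp (toℕ (eval vs (inject₁ i))) (toℕ (eval vs (fsuc i)))
      ... | tri< X-asc _ _ = ⊥-elim (below-·s-no-ascent v′ us vs reduced us≗v′ sortable′ X-asc)
      ... | tri≈ _ tie _   = ⊥-elim (inject₁≢suc i (eval-injective vs (Finₚ.toℕ-injective tie)))
      ... | tri> _ _ desc  = below-·s-descent v′ us vs reduced us≗v′ desc

adjacent-crossing : (h : Fin (suc n) → ℕ) (p : Fin (suc n)) {c : ℕ} → h p < c → ∀ q → toℕ p < toℕ q → c ≤ h q →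
           Σ (Fin n) λ i → toℕ p ≤ toℕ i × suc (toℕ i) ≤ toℕ q × h (inject₁ i) < c × c ≤ h (fsuc i)
adjacent-crossing {n} h p {c} hp<c = <-weakInduction Crosses (λ ()) step
  where
  Crosses : Fin (suc n) → Set
  Crosses q = toℕ p < toℕ q → c ≤ h q →
              Σ (Fin n) λ i → toℕ p ≤ toℕ i × suc (toℕ i) ≤ toℕ q × h (inject₁ i) < c × c ≤ h (fsuc i)
  step : ∀ i → Crosses (inject₁ i) → Crosses (fsuc i)
  step i ih p<1+i c≤h with h (inject₁ i) <? c
  ... | yes below = i , s≤s⁻¹ p<1+i , ≤-refl , below , c≤h
  ... | no ¬below with m≤n⇒m<n∨m≡n (s≤s⁻¹ p<1+i)
  ...   | inj₂ p≡i rewrite Finₚ.toℕ-injective {i = p} {j = inject₁ i} (trans p≡i (sym (Finₚ.toℕ-inject₁ i))) =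
    ⊥-elim (¬below hp<c)
  ...   | inj₁ p<i with ih (subst (toℕ p <_) (sym (Finₚ.toℕ-inject₁ i)) p<i) (≮⇒≥ ¬below)
  ...     | i′ , p≤i′ , i′<i , below , above =
    i′ , p≤i′ , m<n⇒m<1+n (subst (suc (toℕ i′) ≤_) (Finₚ.toℕ-inject₁ i) i′<i) , below , above

singleton⇒avoids132 : (w : Perm n) → Singleton w → Avoids132 (w ⟨$⟩ʳ_)
singleton⇒avoids132 w (sortable , unique) p q r (p<q , q<r , wp<wr , wr<wq)
  with adjacent-crossing (toℕ ∘ (w ⟨$⟩ʳ_)) p wp<wr q p<q (<⇒≤ wr<wq)
... | i , _ , i+1≤q , lo , wr≤wi+1 = inject₁≢suc i (sym (⟨$⟩ʳ-injective w w[i+1]≡w[i]))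
  where
  i+1<r : suc (toℕ i) < toℕ r
  i+1<r = ≤-trans (s≤s i+1≤q) q<r
  hi : toℕ (w ⟨$⟩ʳ r) < toℕ (w ⟨$⟩ʳ fsuc i)
  hi = ≤∧≢⇒< wr≤wi+1 λ e → <-irrefl (cong toℕ (⟨$⟩ʳ-injective w (Finₚ.toℕ-injective (sym e)))) i+1<r
  w[i+1]≡w[i] : w ⟨$⟩ʳ fsuc i ≡ w ⟨$⟩ʳ inject₁ i
  w[i+1]≡w[i] = trans (cong (w ⟨$⟩ʳ_) (sym (sFn-inject₁ i)))
                      (unique (w ·s i) (π↓-·s w i (<-trans lo hi) r lo hi i+1<r sortable) (inject₁ i))

-- Prefix intervals and residues

record PrefixInterval (w : Perm n) (y m : ℕ) : Set where
  field
    inside : ∀ i → toℕ i < y → m ≤ toℕ (w ⟨$⟩ʳ i) × toℕ (w ⟨$⟩ʳ i) < m + y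
    onto   : ∀ v → m ≤ v → v < m + y → Σ (Fin (suc n)) λ i → toℕ i < y × toℕ (w ⟨$⟩ʳ i) ≡ v
open PrefixInterval

prefix-interval-1 : (w : Perm n) → PrefixInterval w 1 (toℕ (w ⟨$⟩ʳ fzero))
prefix-interval-1 w = record
  { inside = λ { fzero _ → ≤-refl , m<m+n _ (s≤s z≤n) ; (fsuc i) (s≤s ()) }
  ; onto   = λ v m≤v v<m+1 → fzero , s≤s z≤n , ≤-antisym m≤v (s≤s⁻¹ (subst (v <_) (+-comm _ 1) v<m+1))
  }

module _ (w : Perm n) {y m : ℕ} (I : PrefixInterval w (suc y) m) (t : Fin (suc n)) (t≡1+y : toℕ t ≡ suc y) where

  private
    e : ℕ
    e = toℕ (w ⟨$⟩ʳ t)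

    prefix-or-t : ∀ i → toℕ i < suc (suc y) → toℕ i < suc y ⊎ i ≡ t
    prefix-or-t i i<2+y with m<1+n⇒m<n∨m≡n i<2+y
    ... | inj₁ i<1+y  = inj₁ i<1+y
    ... | inj₂ i≡1+y = inj₂ (Finₚ.toℕ-injective (trans i≡1+y (sym t≡1+y)))

  extend-below : suc e ≡ m → PrefixInterval w (suc (suc y)) e
  extend-below 1+e≡m = record { inside = inside′ ; onto = onto′ }
    where
    m+1+y≡e+2+y : m + suc y ≡ e + suc (suc y)
    m+1+y≡e+2+y = trans (cong (_+ suc y) (sym 1+e≡m)) (sym (+-suc e (suc y)))
    inside′ : ∀ i → toℕ i < suc (suc y) → e ≤ toℕ (w ⟨$⟩ʳ i) × toℕ (w ⟨$⟩ʳ i) < e + suc (suc y)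
    inside′ i i< with prefix-or-t i i<
    ... | inj₁ i<1+y = <⇒≤ (<-≤-trans (subst (e <_) 1+e≡m (n<1+n e)) (proj₁ (inside I i i<1+y)))
                     , subst (toℕ (w ⟨$⟩ʳ i) <_) m+1+y≡e+2+y (proj₂ (inside I i i<1+y))
    ... | inj₂ refl  = ≤-refl , m<m+n e (s≤s z≤n)
    onto′ : ∀ v → e ≤ v → v < e + suc (suc y) → Σ (Fin (suc n)) λ i → toℕ i < suc (suc y) × toℕ (w ⟨$⟩ʳ i) ≡ v
    onto′ v e≤v v< with m≤n⇒m<n∨m≡n e≤v
    ... | inj₂ refl = t , subst (_< suc (suc y)) (sym t≡1+y) (n<1+n _) , refl
    ... | inj₁ e<v with onto I v (subst (_≤ v) 1+e≡m e<v) (subst (v <_) (sym m+1+y≡e+2+y) v<)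
    ...   | i , i<1+y , wi≡v = i , m<n⇒m<1+n i<1+y , wi≡v

  extend-above : e ≡ m + suc y → PrefixInterval w (suc (suc y)) m
  extend-above e≡m+1+y = record { inside = inside′ ; onto = onto′ }
    where
    m+1+y<m+2+y : m + suc y < m + suc (suc y)
    m+1+y<m+2+y = subst (m + suc y <_) (sym (+-suc m (suc y))) (n<1+n _)
    inside′ : ∀ i → toℕ i < suc (suc y) → m ≤ toℕ (w ⟨$⟩ʳ i) × toℕ (w ⟨$⟩ʳ i) < m + suc (suc y)
    inside′ i i< with prefix-or-t i i<
    ... | inj₁ i<1+y = proj₁ (inside I i i<1+y) , <-trans (proj₂ (inside I i i<1+y)) m+1+y<m+2+y
    ... | inj₂ refl  = subst (m ≤_) (sym e≡m+1+y) (m≤m+n m (suc y))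
                     , subst (_< m + suc (suc y)) (sym e≡m+1+y) m+1+y<m+2+y
    onto′ : ∀ v → m ≤ v → v < m + suc (suc y) → Σ (Fin (suc n)) λ i → toℕ i < suc (suc y) × toℕ (w ⟨$⟩ʳ i) ≡ v
    onto′ v m≤v v< with m<1+n⇒m<n∨m≡n (subst (v <_) (+-suc m (suc y)) v<)
    ... | inj₂ refl = t , subst (_< suc (suc y)) (sym t≡1+y) (n<1+n _) , e≡m+1+y
    ... | inj₁ v<m+1+y with onto I v m≤v v<m+1+y
    ...   | i , i<1+y , wi≡v = i , m<n⇒m<1+n i<1+y , wi≡v

module _ (w : Perm n) (avoids132 : Avoids132 (w ⟨$⟩ʳ_)) (avoids312 : Avoids312 (w ⟨$⟩ʳ_)) where

  private
    position-of : ∀ v → v < suc n → Σ (Fin (suc n)) λ s → toℕ (w ⟨$⟩ʳ s) ≡ v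
    position-of v v<1+n = w ⟨$⟩ˡ fromℕ< v<1+n , trans (cong toℕ (inverseʳ w)) (Finₚ.toℕ-fromℕ< v<1+n)

  module _ {y m : ℕ} (I : PrefixInterval w (suc y) m) (t : Fin (suc n)) (t≡1+y : toℕ t ≡ suc y) where

    private
      e : ℕ
      e = toℕ (w ⟨$⟩ʳ t)

      w0∈ : m ≤ toℕ (w ⟨$⟩ʳ fzero) × toℕ (w ⟨$⟩ʳ fzero) < m + suc y
      w0∈ = inside I fzero (s≤s z≤n)

      0<t : 0 < toℕ t
      0<t = subst (0 <_) (sym t≡1+y) (s≤s z≤n)

      not-in-prefix : m ≤ e → e < m + suc y → ⊥
      not-in-prefix m≤e e< with onto I e m≤e e<
      ... | i , i<1+y , wi≡e = <-irrefl (trans (cong toℕ (⟨$⟩ʳ-injective w (Finₚ.toℕ-injective wi≡e))) t≡1+y) i<1+y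

      after-t : ∀ s → toℕ (w ⟨$⟩ʳ s) < m ⊎ m + suc y ≤ toℕ (w ⟨$⟩ʳ s) → toℕ (w ⟨$⟩ʳ s) ≢ e → toℕ t < toℕ s
      after-t s out-of-range ws≢e with <-cmp (toℕ s) (suc y) | out-of-range
      ... | tri< s<1+y _ _ | inj₁ ws<m      = ⊥-elim (≤⇒≯ (proj₁ (inside I s s<1+y)) ws<m)
      ... | tri< s<1+y _ _ | inj₂ m+1+y≤ws  = ⊥-elim (≤⇒≯ m+1+y≤ws (proj₂ (inside I s s<1+y)))
      ... | tri≈ _ s≡1+y _ | _ =
        ⊥-elim (ws≢e (cong (toℕ ∘ (w ⟨$⟩ʳ_)) (Finₚ.toℕ-injective (trans s≡1+y (sym t≡1+y)))))
      ... | tri> _ _ 1+y<s | _ = subst (_< toℕ s) (sym t≡1+y) 1+y<s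

    -- A value strictly between w(t) and the interval lies right of t and forms a 312 or a 132 with w(0) and w(t).
    next-value-adjacent : suc e ≡ m ⊎ e ≡ m + suc y
    next-value-adjacent with <-cmp e m
    ... | tri≈ _ e≡m _ =
      ⊥-elim (not-in-prefix (≤-reflexive (sym e≡m)) (subst (_< m + suc y) (sym e≡m) (m<m+n m (s≤s z≤n))))
    ... | tri< e<m _ _ with m≤n⇒m<n∨m≡n e<m
    ...   | inj₂ 1+e≡m = inj₁ 1+e≡m
    ...   | inj₁ 1+e<m
      with position-of (suc e) (<-≤-trans 1+e<m (≤-trans (proj₁ w0∈) (<⇒≤ (Finₚ.toℕ<n (w ⟨$⟩ʳ fzero)))))
    ...     | s , ws≡1+e = ⊥-elim (avoids312 fzero t s (0<t , after-t s (inj₁ ws<m) ws≢e , e<ws , ws<w0))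
      where
      ws<m : toℕ (w ⟨$⟩ʳ s) < m
      ws<m = subst (_< m) (sym ws≡1+e) 1+e<m
      ws≢e : toℕ (w ⟨$⟩ʳ s) ≢ e
      ws≢e ws≡e = 1+n≢n (trans (sym ws≡1+e) ws≡e)
      e<ws : e < toℕ (w ⟨$⟩ʳ s)
      e<ws = subst (e <_) (sym ws≡1+e) (n<1+n e)
      ws<w0 : toℕ (w ⟨$⟩ʳ s) < toℕ (w ⟨$⟩ʳ fzero)
      ws<w0 = <-≤-trans ws<m (proj₁ w0∈)
    next-value-adjacent | tri> _ _ m<e with <-cmp e (m + suc y)
    ... | tri< e<m+1+y _ _ = ⊥-elim (not-in-prefix (<⇒≤ m<e) e<m+1+y)
    ... | tri≈ _ e≡m+1+y _ = inj₂ e≡m+1+y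
    ... | tri> _ _ m+1+y<e with position-of (m + suc y) (<-trans m+1+y<e (Finₚ.toℕ<n (w ⟨$⟩ʳ t)))
    ...   | s , ws≡m+1+y =
      ⊥-elim (avoids132 fzero t s (0<t , after-t s (inj₂ (≤-reflexive (sym ws≡m+1+y))) ws≢e , w0<ws , ws<e))
      where
      ws≢e : toℕ (w ⟨$⟩ʳ s) ≢ e
      ws≢e ws≡e = <-irrefl (trans (sym ws≡m+1+y) ws≡e) m+1+y<e
      w0<ws : toℕ (w ⟨$⟩ʳ fzero) < toℕ (w ⟨$⟩ʳ s)
      w0<ws = subst (toℕ (w ⟨$⟩ʳ fzero) <_) (sym ws≡m+1+y) (proj₂ w0∈)
      ws<e : toℕ (w ⟨$⟩ʳ s) < e
      ws<e = subst (_< e) (sym ws≡m+1+y) m+1+y<e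

  prefix-interval : ∀ y → y ≤ n → Σ ℕ (PrefixInterval w (suc y))
  prefix-interval zero    _     = _ , prefix-interval-1 w
  prefix-interval (suc y) 1+y≤n with prefix-interval y (≤-trans (n≤1+n y) 1+y≤n)
  ... | m , I with next-value-adjacent I (fromℕ< (s≤s 1+y≤n)) (Finₚ.toℕ-fromℕ< (s≤s 1+y≤n))
  ...   | inj₁ below = _ , extend-below w I (fromℕ< (s≤s 1+y≤n)) (Finₚ.toℕ-fromℕ< (s≤s 1+y≤n)) below
  ...   | inj₂ above = m , extend-above w I (fromℕ< (s≤s 1+y≤n)) (Finₚ.toℕ-fromℕ< (s≤s 1+y≤n)) above

residue-exists : ∀ a d z → z < suc d → Σ ℕ λ u → a ≤ u × u < a + suc d × u % suc d ≡ z
residue-exists zero    d z z<1+d = z , z≤n , z<1+d , m<n⇒m%n≡m z<1+d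
residue-exists (suc a) d z z<1+d with residue-exists a d z z<1+d
... | u , a≤u , u<a+1+d , u%≡z with m≤n⇒m<n∨m≡n a≤u
...   | inj₁ a<u  = u , a<u , m<n⇒m<1+n u<a+1+d , u%≡z
...   | inj₂ refl = a + suc d , m<m+n a (s≤s z≤n) , n<1+n _ , trans ([m+n]%n≡m%n a (suc d)) u%≡z

%-injective-≤ : ∀ d {u u′} → u ≤ u′ → u′ < u + suc d → u % suc d ≡ u′ % suc d → u ≡ u′
%-injective-≤ d {u} {u′} u≤u′ u′<u+D same-residue = ≤-antisym u≤u′ (m∸n≡0⇒m≤n gap≡0)
  where
  open ≡-Reasoning
  D k : ℕ
  D = suc d
  k = u′ / D ∸ u / D
  gap≡k*D : u′ ∸ u ≡ k * D
  gap≡k*D = begin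
    u′ ∸ u                                      ≡⟨ cong₂ _∸_ (m≡m%n+[m/n]*n u′ D) (m≡m%n+[m/n]*n u D) ⟩
    (u′ % D + u′ / D * D) ∸ (u % D + u / D * D) ≡⟨ cong (λ r → r + u′ / D * D ∸ (u % D + u / D * D)) same-residue ⟨
    (u % D + u′ / D * D) ∸ (u % D + u / D * D)  ≡⟨ [m+n]∸[m+o]≡n∸o (u % D) _ _ ⟩
    u′ / D * D ∸ u / D * D                      ≡⟨ *-distribʳ-∸ D (u′ / D) (u / D) ⟨
    k * D                                       ∎
  gap≡0 : u′ ∸ u ≡ 0
  gap≡0 = begin
    u′ ∸ u           ≡⟨ m<n⇒m%n≡m (subst (u′ ∸ u <_) (m+n∸m≡n u D) (∸-monoˡ-< u′<u+D u≤u′)) ⟨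
    (u′ ∸ u) % D     ≡⟨ cong (_% D) gap≡k*D ⟩
    (k * D) % D      ≡⟨ m*n%n≡0 k D ⟩
    0                ∎

%-injective-window : ∀ a d {u u′} → a ≤ u → u < a + suc d → a ≤ u′ → u′ < a + suc d →
                     u % suc d ≡ u′ % suc d → u ≡ u′
%-injective-window a d {u} {u′} a≤u u< a≤u′ u′< same with ≤-total u u′
... | inj₁ u≤u′ = %-injective-≤ d u≤u′ (<-≤-trans u′< (+-monoˡ-≤ (suc d) a≤u)) same
... | inj₂ u′≤u = sym (%-injective-≤ d u′≤u (<-≤-trans u< (+-monoˡ-≤ (suc d) a≤u′)) (sym same))

InPrefix : Perm n → ℕ → Fin (suc n) → Set
InPrefix {n} w y′ v = Σ (Fin (suc n)) λ i → toℕ i < suc y′ × w ⟨$⟩ʳ i ≡ v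

UniqueResidue : Perm n → (y′ z : ℕ) → Set
UniqueResidue {n} w y′ z = Σ (Fin (suc n)) λ v →
  (InPrefix w y′ v × suc (toℕ v) % suc y′ ≡ z) × (∀ v′ → InPrefix w y′ v′ → suc (toℕ v′) % suc y′ ≡ z → v′ ≡ v)

prefix-interval⇒unique-residue : (w : Perm n) {y′ m : ℕ} → PrefixInterval w (suc y′) m →
                                 ∀ z → z < suc y′ → UniqueResidue w y′ z
prefix-interval⇒unique-residue w {y′} {m} I z z<1+y′ with residue-exists (suc m) y′ z z<1+y′
... | suc v , s≤s m≤v , s≤s v<m+1+y′ , v%≡z with onto I v m≤v v<m+1+y′
...   | i , i<1+y′ , wi≡v =
  w ⟨$⟩ʳ i , ((i , i<1+y′ , refl) , subst (λ x → suc x % suc y′ ≡ z) (sym wi≡v) v%≡z) , unique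
  where
  unique : ∀ v′ → InPrefix w y′ v′ → suc (toℕ v′) % suc y′ ≡ z → v′ ≡ w ⟨$⟩ʳ i
  unique v′ (i′ , i′<1+y′ , refl) v′%≡z with inside I i′ i′<1+y′
  ... | m≤v′ , v′<m+1+y′ = Finₚ.toℕ-injective (trans (suc-injective
        (%-injective-window (suc m) y′ (s≤s m≤v′) (s≤s v′<m+1+y′) (s≤s m≤v) (s≤s v<m+1+y′)
                            (trans v′%≡z (sym v%≡z))))
        (sym wi≡v))

singleton⇒unique-residue : (w : Perm n) → Singleton w → ∀ y′ → y′ ≤ n → ∀ z → z < suc y′ → UniqueResidue w y′ z
singleton⇒unique-residue w singleton y′ y′≤n =
  prefix-interval⇒unique-residue w (proj₂ (prefix-interval w (singleton⇒avoids132 w singleton)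
                                                            (sortable⇒avoids312 w (proj₁ singleton)) y′ y′≤n))

-- Linear functionals on matrices

module _ {a ℓ} (R : CommutativeRing a ℓ) (n : ℕ) where

  private
    module R = CommutativeRing R
  open R using (Carrier; _≈_; 0#; 1#)
  open import Algebra.Properties.CommutativeSemigroup R.+-commutativeSemigroup using (interchange)

  Matrix : Set a
  Matrix = Fin (suc n) → Fin (suc n) → Carrier

  record Linear (L : Matrix → Carrier) : Set (a ⊔ ℓ) where
    field
      ⟦⟧-cong : ∀ {X Y} → (∀ i j → X i j ≈ Y i j) → L X ≈ L Y
      +-homo  : ∀ X Y → L (λ i j → X i j R.+ Y i j) ≈ L X R.+ L Y
      *-homo  : ∀ c X → L (λ i j → c R.* X i j) ≈ c R.* L X
  open Linear

  linear-entry : ∀ i j → Linear (λ X → X i j)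
  linear-entry i j = record { ⟦⟧-cong = λ e → e i j ; +-homo = λ _ _ → R.refl ; *-homo = λ _ _ → R.refl }

  linear-0 : Linear (λ _ → 0#)
  linear-0 = record
    { ⟦⟧-cong = λ _ → R.refl
    ; +-homo  = λ _ _ → R.sym (R.+-identityˡ 0#)
    ; *-homo  = λ c _ → R.sym (R.zeroʳ c)
    }

  linear-+ : ∀ {L L′} → Linear L → Linear L′ → Linear (λ X → L X R.+ L′ X)
  linear-+ l l′ = record
    { ⟦⟧-cong = λ e → R.+-cong (⟦⟧-cong l e) (⟦⟧-cong l′ e)
    ; +-homo  = λ X Y → R.trans (R.+-cong (+-homo l X Y) (+-homo l′ X Y)) (interchange _ _ _ _)
    ; *-homo  = λ c X → R.trans (R.+-cong (*-homo l c X) (*-homo l′ c X)) (R.sym (R.distribˡ c _ _))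
    }

  linear-if : ∀ b {L} → Linear L → Linear (λ X → if b then L X else 0#)
  linear-if true  l = l
  linear-if false l = linear-0

  linear-sumFin : ∀ {m} {L : Fin m → Matrix → Carrier} → (∀ k → Linear (L k)) →
                  Linear (λ X → sumFin R (λ k → L k X))
  linear-sumFin {zero}  l = linear-0
  linear-sumFin {suc m} l = linear-+ (l fzero) (linear-sumFin (l ∘ fsuc))

  linear-zero : ∀ {L} → Linear L → L (λ _ _ → 0#) ≈ 0#
  linear-zero {L} l = R.trans (⟦⟧-cong l (λ _ _ → R.sym (R.zeroˡ 0#)))
                              (R.trans (*-homo l 0# (λ _ _ → 0#)) (R.zeroˡ _))

  linear-combination : ∀ {A : Set} {L} → Linear L → (M : A → Matrix) (cs : List (Carrier × A)) →
                       L (λ i j → sumList R (map (λ p → proj₁ p R.* M (proj₂ p) i j) cs)) ≈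
                       sumList R (map (λ p → proj₁ p R.* L (M (proj₂ p))) cs)
  linear-combination l M []             = linear-zero l
  linear-combination l M ((c , x) ∷ cs) =
    R.trans (+-homo l _ _) (R.+-cong (*-homo l c (M x)) (linear-combination l M cs))

  if-cong : ∀ b {x y} → x ≈ y → (if b then x else 0#) ≈ (if b then y else 0#)
  if-cong true  x≈y = x≈y
  if-cong false _   = R.refl

  if-0 : ∀ b → (if b then 0# else 0#) ≈ 0#
  if-0 true  = R.refl
  if-0 false = R.refl

  sumFin-cong : ∀ {m} {f g : Fin m → Carrier} → (∀ k → f k ≈ g k) → sumFin R f ≈ sumFin R g
  sumFin-cong {zero}  f≈g = R.refl
  sumFin-cong {suc m} f≈g = R.+-cong (f≈g fzero) (sumFin-cong (f≈g ∘ fsuc))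

  sumFin-zero : ∀ {m} (f : Fin m → Carrier) → (∀ k → f k ≈ 0#) → sumFin R f ≈ 0#
  sumFin-zero {zero}  f f≈0 = R.refl
  sumFin-zero {suc m} f f≈0 =
    R.trans (R.+-cong (f≈0 fzero) (sumFin-zero (f ∘ fsuc) (f≈0 ∘ fsuc))) (R.+-identityˡ 0#)

  sumFin-point : ∀ {m} (f : Fin m → Carrier) (v : Fin m) → (∀ k → k ≢ v → f k ≈ 0#) → sumFin R f ≈ f v
  sumFin-point f fzero    f≈0 =
    R.trans (R.+-congˡ (sumFin-zero (f ∘ fsuc) (λ k → f≈0 (fsuc k) λ ()))) (R.+-identityʳ (f fzero))
  sumFin-point f (fsuc v) f≈0 =
    R.trans (R.+-cong (f≈0 fzero λ ())
                      (sumFin-point (f ∘ fsuc) v (λ k k≢v → f≈0 (fsuc k) (k≢v ∘ Finₚ.suc-injective))))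
            (R.+-identityˡ (f (fsuc v)))

  blockSum : (y′ z : ℕ) → Matrix → Carrier
  blockSum y′ z X = sumFin R λ j →
    if ⌊ suc (toℕ j) % suc y′ ≟ z ⌋
    then sumFin R (λ i → if ⌊ suc (toℕ i) ≤? suc y′ ⌋ then X i j else 0#)
    else 0#

  linear-blockSum : ∀ y′ z → Linear (blockSum y′ z)
  linear-blockSum y′ z = linear-sumFin λ j → linear-if ⌊ suc (toℕ j) % suc y′ ≟ z ⌋
                          (linear-sumFin λ i → linear-if ⌊ suc (toℕ i) ≤? suc y′ ⌋ (linear-entry i j))

  -- Column j of X(w) has its only 1 in row w⁻¹(j), so the sum counts the prefix values with residue z.
  blockSum-permMatrix : (w : Perm n) {y′ z : ℕ} → UniqueResidue w y′ z → blockSum y′ z (permMatrix R w) ≈ 1#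
  blockSum-permMatrix w {y′} {z} (v , ((i₀ , i₀<1+y′ , wi₀≡v) , v%≡z) , unique) =
    R.trans (sumFin-cong λ j → if-cong ⌊ suc (toℕ j) % suc y′ ≟ z ⌋ (sumFin-point _ (w ⟨$⟩ˡ j) (off-row j)))
            (R.trans (sumFin-point column v off-column) at-v)
    where
    off-row : ∀ j i → i ≢ w ⟨$⟩ˡ j → (if ⌊ suc (toℕ i) ≤? suc y′ ⌋ then permMatrix R w i j else 0#) ≈ 0#
    off-row j i i≢ with w ⟨$⟩ʳ i Finₚ.≟ j
    ... | yes refl = ⊥-elim (i≢ (sym (inverseˡ w)))
    ... | no _     = if-0 _
    column : Fin (suc n) → Carrier
    column j = if ⌊ suc (toℕ j) % suc y′ ≟ z ⌋
               then (if ⌊ suc (toℕ (w ⟨$⟩ˡ j)) ≤? suc y′ ⌋ then permMatrix R w (w ⟨$⟩ˡ j) j else 0#)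
               else 0#
    off-column : ∀ j → j ≢ v → column j ≈ 0#
    off-column j j≢v with suc (toℕ j) % suc y′ ≟ z | suc (toℕ (w ⟨$⟩ˡ j)) ≤? suc y′
    ... | no _      | _         = R.refl
    ... | yes _     | no _      = R.refl
    ... | yes j%≡z  | yes j∈    = ⊥-elim (j≢v (unique j (w ⟨$⟩ˡ j , j∈ , inverseʳ w) j%≡z))
    at-v : column v ≈ 1#
    at-v with suc (toℕ v) % suc y′ ≟ z | suc (toℕ (w ⟨$⟩ˡ v)) ≤? suc y′ | w ⟨$⟩ʳ (w ⟨$⟩ˡ v) Finₚ.≟ v
    ... | no v%≢z | _      | _        = ⊥-elim (v%≢z v%≡z)
    ... | yes _   | no v∉  | _        =
      ⊥-elim (v∉ (subst (λ i → toℕ i < suc y′) (trans (sym (inverseˡ w)) (cong (w ⟨$⟩ˡ_) wi₀≡v)) i₀<1+y′))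
    ... | yes _   | yes _  | no ≢v    = ⊥-elim (≢v (inverseʳ w))
    ... | yes _   | yes _  | yes _    = R.refl

  blockSum-InAff : (X : Matrix) → InAff R X → ∀ y′ → y′ ≤ n → ∀ z → z < suc y′ → blockSum y′ z X ≈ 1#
  blockSum-InAff X (cs , singletons , weights≈1 , X≈) y′ y′≤n z z<1+y′ = begin
    blockSum y′ z X
      ≈⟨ ⟦⟧-cong (linear-blockSum y′ z) X≈ ⟩
    blockSum y′ z (λ i j → sumList R (map (λ p → proj₁ p R.* permMatrix R (proj₂ p) i j) cs))
      ≈⟨ linear-combination (linear-blockSum y′ z) (permMatrix R) cs ⟩
    sumList R (map (λ p → proj₁ p R.* blockSum y′ z (permMatrix R (proj₂ p))) cs)
      ≈⟨ each-block-1 cs singletons ⟩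
    sumList R (map proj₁ cs)
      ≈⟨ weights≈1 ⟩
    1# ∎
    where
    open import Relation.Binary.Reasoning.Setoid R.setoid
    each-block-1 : ∀ cs → All (λ p → Singleton (proj₂ p)) cs →
                   sumList R (map (λ p → proj₁ p R.* blockSum y′ z (permMatrix R (proj₂ p))) cs) ≈
                   sumList R (map proj₁ cs)
    each-block-1 []             []                = R.refl
    each-block-1 ((c , w) ∷ cs) (singleton ∷ all) =
      R.+-cong (R.trans (R.*-congˡ (blockSum-permMatrix w (singleton⇒unique-residue w singleton y′ y′≤n z z<1+y′)))
                        (R.*-identityʳ c))
               (each-block-1 cs all)

corollary7p1 : ∀ {a ℓ} (n : ℕ) →
    -- (1) for y = suc y′ ∈ [n+1] and 0 ≤ z ≤ y-1, exactly one value v+1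
    --     among w(1),...,w(y) satisfies v+1 ≡ z (mod y)
    ((w : Perm n) → Singleton w → (y′ : ℕ) → y′ ≤ n → (z : ℕ) → z < suc y′ →
      Σ (Fin (suc n)) λ v →
        ((Σ (Fin (suc n)) λ i → toℕ i < suc y′ × w ⟨$⟩ʳ i ≡ v) × suc (toℕ v) % suc y′ ≡ z)
        × ((v′ : Fin (suc n)) →
             (Σ (Fin (suc n)) λ i → toℕ i < suc y′ × w ⟨$⟩ʳ i ≡ v′) →
             suc (toℕ v′) % suc y′ ≡ z → v′ ≡ v))
    ×
    -- (2) for every X ∈ Aff(c):  Σ_{j ≡ z (mod y)} Σ_{i=1}^{y} X(i,j) = 1
    ((R : CommutativeRing a ℓ) → (X : Fin (suc n) → Fin (suc n) → CommutativeRing.Carrier R) →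
      InAff R X → (y′ : ℕ) → y′ ≤ n → (z : ℕ) → z < suc y′ →
      CommutativeRing._≈_ R
        (sumFin R λ j →
          if ⌊ suc (toℕ j) % suc y′ ≟ z ⌋
          then sumFin R (λ i → if ⌊ suc (toℕ i) ≤? suc y′ ⌋ then X i j else CommutativeRing.0# R)
          else CommutativeRing.0# R)
        (CommutativeRing.1# R))
corollary7p1 n = singleton⇒unique-residue , λ R X → blockSum-InAff R n X
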